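{- Let $G$ be a graph and let $A_1,A_2 \subseteq V(G)$. Write $O_i = V(G)\setminus(A_i\cup\partial A_i)$ and define $P=A_1\cap A_2$, $Q=\partial A_1\cap A_2$, $S=O_1\cap A_2$, $T=A_1\cap\partial A_2$, $U=\partial A_1\cap\partial A_2$, $W=O_1\cap\partial A_2$, $X=A_1\cap O_2$, $Y=\partial A_1\cap O_2$, $Z=O_1\cap O_2$. Then: (i) $|\partial P| + |\partial (P \cup Q \cup S \cup T \cup X)| \le |\partial A_1| + |\partial A_2|$; (ii) $|\partial S| + |\partial X| \le |\partial A_1| + |\partial A_2|$; (iii) if $|\partial A_2| = |\partial P| = |\partial S| = k$, then $|Q\cup U| = |\partial A_1 \cap (A_2 \cup \partial A_2)| \ge \frac{k}{2}$.
   Context: $\partial X = \{ v \in V(G)\setminus X : uv \in E(G) \text{ for some } u \in X\}$. -}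

module Defs where

open import Data.Nat using (ℕ; zero; suc)
open import Data.Bool using (Bool; true; false; not; _∧_; _∨_)
open import Data.Fin using (Fin; zero; suc)
open import Data.Vec using (lookup; tabulate)
open import Data.Fin.Subset using (Subset; _∩_; _∪_; ∁)
open import Relation.Binary.PropositionalEquality using (_≡_)

record Graph (n : ℕ) : Set where
  field
    adj    : Fin n → Fin n → Bool
    sym    : ∀ u v → adj u v ≡ adj v u
    irrefl : ∀ v → adj v v ≡ false
open Graph public

anyFin : {n : ℕ} → (Fin n → Bool) → Bool
anyFin {zero}  p = false
anyFin {suc n} p = p zero ∨ anyFin (λ i → p (suc i))

∂ : {n : ℕ} → Graph n → Subset n → Subset n
∂ G X = tabulate (λ v → not (lookup X v) ∧ anyFin (λ u → lookup X u ∧ adj G u v))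

Out : {n : ℕ} → Graph n → Subset n → Subset n
Out G A = ∁ (A ∪ ∂ G A)

module Submission where

-- Each inequality is counted vertex by vertex: as |p| + |q| = |p ∪ q| + |p ∩ q|, it suffices
-- that p ∪ q ⊆ r ∪ s and p ∩ q ⊆ r ∩ s (for (iii): ∂P ∪ ∂S ⊆ ∂A₂ ∪ C and ∂P ∩ ∂S ⊆ C with
-- C = ∂A₁ ∩ (A₂ ∪ ∂A₂)). These inclusions rest on three facts about the boundary of a set Y:
-- it is disjoint from Y, it lies in Z ∪ ∂Z whenever Y ⊆ Z, and it misses Z whenever
-- Y ⊆ Out Z. The cells P, Q, S, T, X make up A₁ ∪ A₂, so (i) is submodularity of |∂ ·|.

open import Defs hiding (sym)
open import Data.Bool using (Bool; true; false; not; _∧_; _∨_; T)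
open import Data.Bool.Properties using (T-≡; T-∧; T-∨)
open import Data.Fin using (Fin; zero; suc)
open import Data.Fin.Subset using (Subset; _∩_; _∪_; ∁; ∣_∣; _∈_; _∉_; _⊆_; inside; outside)
open import Data.Fin.Subset.Properties
  using (_∈?_; p⊆q⇒∣p∣≤∣q∣; p∩q⊆p; p∩q⊆q; x∈p∩q⁺; x∈p∩q⁻; x∈p∪q⁺; x∈p∪q⁻; x∈∁p⇒x∉p; x∉∁p⇒x∈p;
         ∩-comm; ∪-comm; ∩-distribˡ-∪)
open import Data.Nat using (ℕ; suc; _+_; _*_; _≤_)
open import Data.Nat.Properties
  using (+-suc; +-assoc; +-identityʳ; +-mono-≤; +-monoˡ-≤; m≤m+n; ≤-trans; ≤-reflexive; +-cancelˡ-≤;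
         module ≤-Reasoning)
open import Data.Product using (_×_; _,_; proj₁; ∃-syntax)
open import Data.Sum using (_⊎_; inj₁; inj₂; [_,_])
open import Data.Vec using ([]; _∷_; lookup)
open import Data.Vec.Properties using (lookup∘tabulate; []=⇒lookup; lookup⇒[]=)
open import Function using (_∘_; id)
open import Function.Bundles using (_⇔_; mk⇔; Equivalence)
open import Relation.Nullary using (¬_; yes; no; contradiction)
open import Relation.Binary.PropositionalEquality using (_≡_; refl; sym; trans; cong; cong₂; subst)

open Equivalence using (to; from)

∣p∪q∣+∣p∩q∣≡∣p∣+∣q∣ : ∀ {n} (p q : Subset n) → ∣ p ∪ q ∣ + ∣ p ∩ q ∣ ≡ ∣ p ∣ + ∣ q ∣
∣p∪q∣+∣p∩q∣≡∣p∣+∣q∣ []            []            = refl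
∣p∪q∣+∣p∩q∣≡∣p∣+∣q∣ (inside  ∷ p) (inside  ∷ q) =
  cong suc (trans (+-suc _ _) (trans (cong suc (∣p∪q∣+∣p∩q∣≡∣p∣+∣q∣ p q)) (sym (+-suc _ _))))
∣p∪q∣+∣p∩q∣≡∣p∣+∣q∣ (inside  ∷ p) (outside ∷ q) = cong suc (∣p∪q∣+∣p∩q∣≡∣p∣+∣q∣ p q)
∣p∪q∣+∣p∩q∣≡∣p∣+∣q∣ (outside ∷ p) (inside  ∷ q) =
  trans (cong suc (∣p∪q∣+∣p∩q∣≡∣p∣+∣q∣ p q)) (sym (+-suc _ _))
∣p∪q∣+∣p∩q∣≡∣p∣+∣q∣ (outside ∷ p) (outside ∷ q) = ∣p∪q∣+∣p∩q∣≡∣p∣+∣q∣ p q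

∣p∪q∣≤∣p∣+∣q∣ : ∀ {n} (p q : Subset n) → ∣ p ∪ q ∣ ≤ ∣ p ∣ + ∣ q ∣
∣p∪q∣≤∣p∣+∣q∣ p q = ≤-trans (m≤m+n _ _) (≤-reflexive (∣p∪q∣+∣p∩q∣≡∣p∣+∣q∣ p q))

∪∩⊆⇒∣p∣+∣q∣≤∣r∣+∣s∣ : ∀ {n} {p q r s : Subset n} →
  p ∪ q ⊆ r ∪ s → p ∩ q ⊆ r ∩ s → ∣ p ∣ + ∣ q ∣ ≤ ∣ r ∣ + ∣ s ∣
∪∩⊆⇒∣p∣+∣q∣≤∣r∣+∣s∣ {p = p} {q} {r} {s} p∪q⊆r∪s p∩q⊆r∩s = begin
  ∣ p ∣ + ∣ q ∣             ≡⟨ sym (∣p∪q∣+∣p∩q∣≡∣p∣+∣q∣ p q) ⟩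
  ∣ p ∪ q ∣ + ∣ p ∩ q ∣     ≤⟨ +-mono-≤ (p⊆q⇒∣p∣≤∣q∣ p∪q⊆r∪s) (p⊆q⇒∣p∣≤∣q∣ p∩q⊆r∩s) ⟩
  ∣ r ∪ s ∣ + ∣ r ∩ s ∣     ≡⟨ ∣p∪q∣+∣p∩q∣≡∣p∣+∣q∣ r s ⟩
  ∣ r ∣ + ∣ s ∣             ∎
  where open ≤-Reasoning

p⊆r∧q⊆r⇒p∪q⊆r : ∀ {n} {p q r : Subset n} → p ⊆ r → q ⊆ r → p ∪ q ⊆ r
p⊆r∧q⊆r⇒p∪q⊆r {p = p} {q} p⊆r q⊆r = [ p⊆r , q⊆r ] ∘ x∈p∪q⁻ p q

x∈p∪q∧x∉p⇒x∈q : ∀ {n} {p q : Subset n} {x} → x ∈ p ∪ q → x ∉ p → x ∈ q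
x∈p∪q∧x∉p⇒x∈q {p = p} {q} x∈p∪q x∉p = [ (λ x∈p → contradiction x∈p x∉p) , id ] (x∈p∪q⁻ p q x∈p∪q)

-- With r = ∂ p and s = ∂ q the five sets on the left are the cells P, Q, S, T, X.
cells-cover : ∀ {n} (p q r s : Subset n) →
  (p ∩ q) ∪ (r ∩ q) ∪ (∁ (p ∪ r) ∩ q) ∪ (p ∩ s) ∪ (p ∩ ∁ (q ∪ s)) ≡ p ∪ q
cells-cover []      []      []      []      = refl
cells-cover (a ∷ p) (b ∷ q) (c ∷ r) (d ∷ s) = cong₂ _∷_ (cover a b c d) (cells-cover p q r s)
  where
  cover : ∀ a b c d →
    (a ∧ b) ∨ (c ∧ b) ∨ (not (a ∨ c) ∧ b) ∨ (a ∧ d) ∨ (a ∧ not (b ∨ d)) ≡ a ∨ b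
  cover true  true  _     _     = refl
  cover true  false true  true  = refl
  cover true  false true  false = refl
  cover true  false false true  = refl
  cover true  false false false = refl
  cover false true  true  _     = refl
  cover false true  false _     = refl
  cover false false true  _     = refl
  cover false false false _     = refl

anyFin-witness : ∀ {n} (f : Fin n → Bool) → T (anyFin f) → ∃[ u ] T (f u)
anyFin-witness {suc n} f h with to T-∨ h
... | inj₁ f0 = zero , f0
... | inj₂ h′ with anyFin-witness (f ∘ suc) h′
...   | u , fu = suc u , fu

anyFin-intro : ∀ {n} (f : Fin n → Bool) u → T (f u) → T (anyFin f)
anyFin-intro f zero    fu = from T-∨ (inj₁ fu)
anyFin-intro f (suc u) fu = from T-∨ (inj₂ (anyFin-intro (f ∘ suc) u fu))

∈⇔T-lookup : ∀ {n} {x : Fin n} {p} → x ∈ p ⇔ T (lookup p x)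
∈⇔T-lookup {x = x} {p} = mk⇔ (from T-≡ ∘ []=⇒lookup) (lookup⇒[]= x p ∘ to T-≡)

∉⇔T-not-lookup : ∀ {n} {x : Fin n} {p} → x ∉ p ⇔ T (not (lookup p x))
∉⇔T-not-lookup {x = x} {p} = mk⇔
  (λ x∉p → ¬T⇒T-not (x∉p ∘ from ∈⇔T-lookup))
  (λ t x∈p → T-not⇒¬T t (to ∈⇔T-lookup x∈p))
  where
  ¬T⇒T-not : ∀ {b} → ¬ T b → T (not b)
  ¬T⇒T-not {true}  ¬t = ¬t _
  ¬T⇒T-not {false} _  = _
  T-not⇒¬T : ∀ {b} → T (not b) → ¬ T b
  T-not⇒¬T {true} ()

module _ {n : ℕ} (G : Graph n) where

  ∈∂⇔ : ∀ {p x} → x ∈ ∂ G p ⇔ (x ∉ p × ∃[ u ] u ∈ p × T (adj G u x))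
  ∈∂⇔ {p} {x} = mk⇔ ⇒ ⇐
    where
    unfold : lookup (∂ G p) x ≡ not (lookup p x) ∧ anyFin (λ u → lookup p u ∧ adj G u x)
    unfold = lookup∘tabulate _ x
    ⇒ : x ∈ ∂ G p → x ∉ p × ∃[ u ] u ∈ p × T (adj G u x)
    ⇒ x∈∂p with to T-∧ (subst T unfold (to ∈⇔T-lookup x∈∂p))
    ... | x∉p , some-u with anyFin-witness _ some-u
    ...   | u , u∈p∧u~x with to T-∧ u∈p∧u~x
    ...     | u∈p , u~x = from ∉⇔T-not-lookup x∉p , u , from ∈⇔T-lookup u∈p , u~x
    ⇐ : x ∉ p × ∃[ u ] u ∈ p × T (adj G u x) → x ∈ ∂ G p
    ⇐ (x∉p , u , u∈p , u~x) = from ∈⇔T-lookup (subst T (sym unfold) (from T-∧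
      (to ∉⇔T-not-lookup x∉p , anyFin-intro _ u (from T-∧ (to ∈⇔T-lookup u∈p , u~x)))))

  x∈∂p⇒x∉p : ∀ {p x} → x ∈ ∂ G p → x ∉ p
  x∈∂p⇒x∉p = proj₁ ∘ to ∈∂⇔

  u∈p∧u~x⇒x∈p∪∂p : ∀ {p u x} → u ∈ p → T (adj G u x) → x ∈ p ∪ ∂ G p
  u∈p∧u~x⇒x∈p∪∂p {p} {u} {x} u∈p u~x with x ∈? p
  ... | yes x∈p = x∈p∪q⁺ (inj₁ x∈p)
  ... | no  x∉p = x∈p∪q⁺ (inj₂ (from ∈∂⇔ (x∉p , u , u∈p , u~x)))

  p⊆q⇒∂p⊆q∪∂q : ∀ {p q} → p ⊆ q → ∂ G p ⊆ q ∪ ∂ G q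
  p⊆q⇒∂p⊆q∪∂q p⊆q x∈∂p with to ∈∂⇔ x∈∂p
  ... | _ , u , u∈p , u~x = u∈p∧u~x⇒x∈p∪∂p (p⊆q u∈p) u~x

  p⊆q∧x∈∂p∧x∉q⇒x∈∂q : ∀ {p q x} → p ⊆ q → x ∈ ∂ G p → x ∉ q → x ∈ ∂ G q
  p⊆q∧x∈∂p∧x∉q⇒x∈∂q p⊆q x∈∂p = x∈p∪q∧x∉p⇒x∈q (p⊆q⇒∂p⊆q∪∂q p⊆q x∈∂p)

  p⊆Out[q]∧x∈∂p⇒x∉q : ∀ {p q x} → p ⊆ Out G q → x ∈ ∂ G p → x ∉ q
  p⊆Out[q]∧x∈∂p⇒x∉q {x = x} p⊆Out[q] x∈∂p x∈q with to ∈∂⇔ x∈∂p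
  ... | _ , u , u∈p , u~x =
    x∈∁p⇒x∉p (p⊆Out[q] u∈p) (u∈p∧u~x⇒x∈p∪∂p x∈q (subst T (Graph.sym G u x) u~x))

  x∈∂[p∩q]∧x∈q⇒x∈∂p : ∀ p q {x} → x ∈ ∂ G (p ∩ q) → x ∈ q → x ∈ ∂ G p
  x∈∂[p∩q]∧x∈q⇒x∈∂p p q x∈∂P x∈q = p⊆q∧x∈∂p∧x∉q⇒x∈∂q (p∩q⊆p p q) x∈∂P
    (λ x∈p → x∈∂p⇒x∉p x∈∂P (x∈p∩q⁺ (x∈p , x∈q)))

  ∂-submodular : ∀ p q → ∣ ∂ G (p ∩ q) ∣ + ∣ ∂ G (p ∪ q) ∣ ≤ ∣ ∂ G p ∣ + ∣ ∂ G q ∣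
  ∂-submodular p q = ∪∩⊆⇒∣p∣+∣q∣≤∣r∣+∣s∣ (p⊆r∧q⊆r⇒p∪q⊆r ∂[p∩q]⊆ ∂[p∪q]⊆) ∂[p∩q]∩∂[p∪q]⊆
    where
    ∂[p∩q]⊆ : ∂ G (p ∩ q) ⊆ ∂ G p ∪ ∂ G q
    ∂[p∩q]⊆ x∈∂P with x∈p∪q⁻ q (∂ G q) (p⊆q⇒∂p⊆q∪∂q (p∩q⊆q p q) x∈∂P)
    ... | inj₁ x∈q  = x∈p∪q⁺ (inj₁ (x∈∂[p∩q]∧x∈q⇒x∈∂p p q x∈∂P x∈q))
    ... | inj₂ x∈∂q = x∈p∪q⁺ (inj₂ x∈∂q)

    ∂[p∪q]⊆ : ∂ G (p ∪ q) ⊆ ∂ G p ∪ ∂ G q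
    ∂[p∪q]⊆ x∈∂R with to ∈∂⇔ x∈∂R
    ... | x∉p∪q , u , u∈p∪q , u~x with x∈p∪q⁻ p q u∈p∪q
    ...   | inj₁ u∈p = x∈p∪q⁺ (inj₁ (from ∈∂⇔ (x∉p∪q ∘ x∈p∪q⁺ ∘ inj₁ , u , u∈p , u~x)))
    ...   | inj₂ u∈q = x∈p∪q⁺ (inj₂ (from ∈∂⇔ (x∉p∪q ∘ x∈p∪q⁺ ∘ inj₂ , u , u∈q , u~x)))

    ∂[p∩q]∩∂[p∪q]⊆ : ∂ G (p ∩ q) ∩ ∂ G (p ∪ q) ⊆ ∂ G p ∩ ∂ G q
    ∂[p∩q]∩∂[p∪q]⊆ {x} x∈ with x∈p∩q⁻ _ _ x∈
    ... | x∈∂P , x∈∂R = x∈p∩q⁺ (p⊆q∧x∈∂p∧x∉q⇒x∈∂q (p∩q⊆p p q) x∈∂P (x∉p∪q ∘ inj₁)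
                               , p⊆q∧x∈∂p∧x∉q⇒x∈∂q (p∩q⊆q p q) x∈∂P (x∉p∪q ∘ inj₂))
      where
      x∉p∪q : ¬ (x ∈ p ⊎ x ∈ q)
      x∉p∪q = x∈∂p⇒x∉p x∈∂R ∘ x∈p∪q⁺

  x∈∂[Out[p]∩q]∧x∈q⇒x∈∂p : ∀ p q {x} → x ∈ ∂ G (Out G p ∩ q) → x ∈ q → x ∈ ∂ G p
  x∈∂[Out[p]∩q]∧x∈q⇒x∈∂p p q x∈∂S x∈q = x∈p∪q∧x∉p⇒x∈q
    (x∉∁p⇒x∈p (λ x∈Out[p] → x∈∂p⇒x∉p x∈∂S (x∈p∩q⁺ (x∈Out[p] , x∈q))))
    (p⊆Out[q]∧x∈∂p⇒x∉q (p∩q⊆p (Out G p) q) x∈∂S)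

  ∂[Out[p]∩q]⊆∂p∪∂q : ∀ p q → ∂ G (Out G p ∩ q) ⊆ ∂ G p ∪ ∂ G q
  ∂[Out[p]∩q]⊆∂p∪∂q p q x∈∂S with x∈p∪q⁻ q (∂ G q) (p⊆q⇒∂p⊆q∪∂q (p∩q⊆q (Out G p) q) x∈∂S)
  ... | inj₁ x∈q  = x∈p∪q⁺ (inj₁ (x∈∂[Out[p]∩q]∧x∈q⇒x∈∂p p q x∈∂S x∈q))
  ... | inj₂ x∈∂q = x∈p∪q⁺ (inj₂ x∈∂q)

  -- The boundary analogue of posimodularity, with q ∖ (p ∪ ∂p) in place of q ∖ p.
  ∂-posimodular : ∀ p q → ∣ ∂ G (Out G p ∩ q) ∣ + ∣ ∂ G (p ∩ Out G q) ∣ ≤ ∣ ∂ G p ∣ + ∣ ∂ G q ∣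
  ∂-posimodular p q = ∪∩⊆⇒∣p∣+∣q∣≤∣r∣+∣s∣
    (p⊆r∧q⊆r⇒p∪q⊆r (∂[Out[p]∩q]⊆∂p∪∂q p q) ∂[p∩Out[q]]⊆) ∂[Out[p]∩q]∩∂[p∩Out[q]]⊆
    where
    ∂[p∩Out[q]]⊆ : ∂ G (p ∩ Out G q) ⊆ ∂ G p ∪ ∂ G q
    ∂[p∩Out[q]]⊆ {x} x∈∂X = subst (x ∈_) (∪-comm (∂ G q) (∂ G p))
      (∂[Out[p]∩q]⊆∂p∪∂q q p (subst (λ r → x ∈ ∂ G r) (∩-comm p (Out G q)) x∈∂X))

    ∂[Out[p]∩q]∩∂[p∩Out[q]]⊆ : ∂ G (Out G p ∩ q) ∩ ∂ G (p ∩ Out G q) ⊆ ∂ G p ∩ ∂ G q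
    ∂[Out[p]∩q]∩∂[p∩Out[q]]⊆ x∈ with x∈p∩q⁻ _ _ x∈
    ... | x∈∂S , x∈∂X = x∈p∩q⁺
      ( p⊆q∧x∈∂p∧x∉q⇒x∈∂q (p∩q⊆p p (Out G q)) x∈∂X (p⊆Out[q]∧x∈∂p⇒x∉q (p∩q⊆p (Out G p) q) x∈∂S)
      , p⊆q∧x∈∂p∧x∉q⇒x∈∂q (p∩q⊆q (Out G p) q) x∈∂S (p⊆Out[q]∧x∈∂p⇒x∉q (p∩q⊆q p (Out G q)) x∈∂X))

  ∂[p∩q]+∂[Out[p]∩q]≤ : ∀ p q →
    ∣ ∂ G (p ∩ q) ∣ + ∣ ∂ G (Out G p ∩ q) ∣ ≤ ∣ ∂ G q ∣ + 2 * ∣ ∂ G p ∩ (q ∪ ∂ G q) ∣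
  ∂[p∩q]+∂[Out[p]∩q]≤ p q = begin
    ∣ ∂P ∣ + ∣ ∂S ∣                ≡⟨ sym (∣p∪q∣+∣p∩q∣≡∣p∣+∣q∣ ∂P ∂S) ⟩
    ∣ ∂P ∪ ∂S ∣ + ∣ ∂P ∩ ∂S ∣      ≤⟨ +-mono-≤ (p⊆q⇒∣p∣≤∣q∣ (p⊆r∧q⊆r⇒p∪q⊆r ∂P⊆ ∂S⊆))
                                                (p⊆q⇒∣p∣≤∣q∣ ∂P∩∂S⊆) ⟩
    ∣ ∂ G q ∪ C ∣ + ∣ C ∣           ≤⟨ +-monoˡ-≤ ∣ C ∣ (∣p∪q∣≤∣p∣+∣q∣ (∂ G q) C) ⟩
    ∣ ∂ G q ∣ + ∣ C ∣ + ∣ C ∣       ≡⟨ +-assoc (∣ ∂ G q ∣) (∣ C ∣) (∣ C ∣) ⟩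
    ∣ ∂ G q ∣ + (∣ C ∣ + ∣ C ∣)     ≡⟨ cong (λ m → ∣ ∂ G q ∣ + (∣ C ∣ + m)) (sym (+-identityʳ ∣ C ∣)) ⟩
    ∣ ∂ G q ∣ + 2 * ∣ C ∣           ∎
    where
    open ≤-Reasoning
    ∂P ∂S C : Subset n
    ∂P = ∂ G (p ∩ q)
    ∂S = ∂ G (Out G p ∩ q)
    C  = ∂ G p ∩ (q ∪ ∂ G q)

    ∂P⊆ : ∂P ⊆ ∂ G q ∪ C
    ∂P⊆ x∈∂P with x∈p∪q⁻ q (∂ G q) (p⊆q⇒∂p⊆q∪∂q (p∩q⊆q p q) x∈∂P)
    ... | inj₂ x∈∂q = x∈p∪q⁺ (inj₁ x∈∂q)
    ... | inj₁ x∈q  = x∈p∪q⁺ (inj₂ (x∈p∩q⁺ (x∈∂[p∩q]∧x∈q⇒x∈∂p p q x∈∂P x∈q , x∈p∪q⁺ (inj₁ x∈q))))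

    ∂S⊆ : ∂S ⊆ ∂ G q ∪ C
    ∂S⊆ x∈∂S with x∈p∪q⁻ q (∂ G q) (p⊆q⇒∂p⊆q∪∂q (p∩q⊆q (Out G p) q) x∈∂S)
    ... | inj₂ x∈∂q = x∈p∪q⁺ (inj₁ x∈∂q)
    ... | inj₁ x∈q  = x∈p∪q⁺ (inj₂ (x∈p∩q⁺ (x∈∂[Out[p]∩q]∧x∈q⇒x∈∂p p q x∈∂S x∈q , x∈p∪q⁺ (inj₁ x∈q))))

    ∂P∩∂S⊆ : ∂P ∩ ∂S ⊆ C
    ∂P∩∂S⊆ x∈ with x∈p∩q⁻ ∂P ∂S x∈
    ... | x∈∂P , x∈∂S = x∈p∩q⁺
      ( p⊆q∧x∈∂p∧x∉q⇒x∈∂q (p∩q⊆p p q) x∈∂P (p⊆Out[q]∧x∈∂p⇒x∉q (p∩q⊆p (Out G p) q) x∈∂S)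
      , p⊆q⇒∂p⊆q∪∂q (p∩q⊆q p q) x∈∂P)

lemma2p1 : (n : ℕ) (G : Graph n) (A₁ A₂ : Subset n) →
    let O₁ = Out G A₁
        O₂ = Out G A₂
        P = A₁ ∩ A₂
        Q = ∂ G A₁ ∩ A₂
        S = O₁ ∩ A₂
        T = A₁ ∩ ∂ G A₂
        U = ∂ G A₁ ∩ ∂ G A₂
        W = O₁ ∩ ∂ G A₂
        X = A₁ ∩ O₂
        Y = ∂ G A₁ ∩ O₂
        Z = O₁ ∩ O₂
    in (∣ ∂ G P ∣ + ∣ ∂ G (P ∪ Q ∪ S ∪ T ∪ X) ∣ ≤ ∣ ∂ G A₁ ∣ + ∣ ∂ G A₂ ∣)
       × (∣ ∂ G S ∣ + ∣ ∂ G X ∣ ≤ ∣ ∂ G A₁ ∣ + ∣ ∂ G A₂ ∣)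
       × ((k : ℕ) → ∣ ∂ G A₂ ∣ ≡ k → ∣ ∂ G P ∣ ≡ k → ∣ ∂ G S ∣ ≡ k →
            (∣ Q ∪ U ∣ ≡ ∣ ∂ G A₁ ∩ (A₂ ∪ ∂ G A₂) ∣) × (k ≤ 2 * ∣ Q ∪ U ∣))
lemma2p1 n G A₁ A₂ =
    subst (λ R → ∣ ∂ G (A₁ ∩ A₂) ∣ + ∣ ∂ G R ∣ ≤ ∣ ∂ G A₁ ∣ + ∣ ∂ G A₂ ∣)
          (sym (cells-cover A₁ A₂ (∂ G A₁) (∂ G A₂))) (∂-submodular G A₁ A₂)
  , ∂-posimodular G A₁ A₂
  , λ k ∣∂A₂∣≡k ∣∂P∣≡k ∣∂S∣≡k → ∣Q∪U∣≡∣C∣ , +-cancelˡ-≤ k k (2 * ∣ Q∪U ∣) (begin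
      k + k                                     ≡⟨ sym (cong₂ _+_ ∣∂P∣≡k ∣∂S∣≡k) ⟩
      ∣ ∂ G (A₁ ∩ A₂) ∣ + ∣ ∂ G (Out G A₁ ∩ A₂) ∣ ≤⟨ ∂[p∩q]+∂[Out[p]∩q]≤ G A₁ A₂ ⟩
      ∣ ∂ G A₂ ∣ + 2 * ∣ C ∣                     ≡⟨ cong₂ _+_ ∣∂A₂∣≡k (cong (2 *_) (sym ∣Q∪U∣≡∣C∣)) ⟩
      k + 2 * ∣ Q∪U ∣                           ∎)
  where
  open ≤-Reasoning
  Q∪U C : Subset n
  Q∪U = (∂ G A₁ ∩ A₂) ∪ (∂ G A₁ ∩ ∂ G A₂)
  C   = ∂ G A₁ ∩ (A₂ ∪ ∂ G A₂)
  ∣Q∪U∣≡∣C∣ : ∣ Q∪U ∣ ≡ ∣ C ∣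
  ∣Q∪U∣≡∣C∣ = cong ∣_∣ (sym (∩-distribˡ-∪ (∂ G A₁) A₂ (∂ G A₂)))
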